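{- Let $\mathbf{d}=(d_1\ge d_2\ge\cdots\ge d_n)$ be a zero-free graphical degree sequence (all $d_i\ge 1$). Run the following procedure on $\mathbf{d}$: (1) If $d_1\ge n-2$ or $d_n\ge\lfloor n/2\rfloor$, output True. (2) Otherwise, if $d_1=d_n$, output False. (3) Otherwise, let $s_u=\max\{s\in\{1,\dots,n-1\}: s<n-d_{s+1}\}$. If there exists an integer $s$ with $d_1+1\le s\le s_u$ such that both $(d_1,\dots,d_s)$ and $(d_{s+1},\dots,d_n)$ are graphical degree sequences, output False. (4) Otherwise, for each integer $l$ with $d_n+1\le l\le \min\{\lfloor n/2\rfloor,\ n-d_1-1\}$: if $d_{n+1-l}<l$, let $m=\min\{i: d_i<l\}$; if moreover $l\le n-m$, then for every choice of $l$ indices from $\{m,m+1,\dots,n\}$, let $\mathbf{s_1}$ be the sequence of the corresponding $l$ terms of $\mathbf{d}$ and $\mathbf{s_2}$ the sequence of the remaining $n-l$ terms of $\mathbf{d}$; if $\mathbf{s_1}$ and $\mathbf{s_2}$ both have even sum and are both graphical degree sequences, output False (and stop). (5) If the procedure has not output anything in steps (1)–(4), output True. Then the procedure outputs True if and only if $\mathbf{d}$ is forcibly connected.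
   Context: A graphical degree sequence is a non-increasing sequence of non-negative integers that is the degree sequence of some simple graph (finite, undirected, no loops or multiple edges); such a graph is a realization of the sequence. A graphical degree sequence is zero-free if all its terms are positive. A graphical degree sequence is forcibly connected if every realization of it is connected (equivalently, it cannot be split into two nonempty subsequences, as multisets, that are each graphical degree sequences). Sub-sequences are always taken in non-increasing order. -}

module Defs where

open import Data.Bool using (Bool; true; false; if_then_else_; not)
open import Data.Nat using (ℕ; zero; suc; _+_; _∸_; _≤_; _<_; _≥_; _<ᵇ_; _⊔_; _⊓_; ⌊_/2⌋)
open import Data.Nat.Divisibility using (_∣_)
open import Data.Fin using (Fin; zero; suc)
open import Data.Nat.ListAction using (sum)
open import Data.List using (List; []; _∷_; length; map; foldr; upTo; allFin; take; drop; lookup)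
open import Data.List.Relation.Unary.All using (All)
open import Data.List.Relation.Unary.Linked using (Linked)
open import Data.Product using (Σ; ∃; _×_; _,_)
open import Data.Sum using (_⊎_)
open import Relation.Nullary using (¬_)
open import Relation.Binary.PropositionalEquality using (_≡_)
open import Relation.Binary.Construct.Closure.ReflexiveTransitive using (Star)

record Graph (n : ℕ) : Set where
  field
    adj   : Fin n → Fin n → Bool
    sym   : ∀ i j → adj i j ≡ adj j i
    irref : ∀ i → adj i i ≡ false
open Graph public

degree : ∀ {n} → Graph n → Fin n → ℕ
degree {n} G i = sum (map (λ j → if adj G i j then 1 else 0) (allFin n))

Realizes : (d : List ℕ) → Graph (length d) → Set
Realizes d G = ∀ i → degree G i ≡ lookup d i

Edge : ∀ {n} → Graph n → Fin n → Fin n → Set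
Edge G i j = adj G i j ≡ true

Connected : ∀ {n} → Graph n → Set
Connected {n} G = ∀ (i j : Fin n) → Star (Edge G) i j

NonIncreasing : List ℕ → Set
NonIncreasing = Linked _≥_

Graphical : List ℕ → Set
Graphical d = NonIncreasing d × Σ (Graph (length d)) (λ G → Realizes d G)

ZeroFree : List ℕ → Set
ZeroFree d = All (λ x → 1 ≤ x) d

ForciblyConnected : List ℕ → Set
ForciblyConnected d = ∀ (G : Graph (length d)) → Realizes d G → Connected G

-- at d i = d_i for 1 ≤ i ≤ length d (0 otherwise, never used out of range)
at : List ℕ → ℕ → ℕ
at []       _             = 0
at (x ∷ xs) zero          = 0
at (x ∷ xs) (suc zero)    = x
at (x ∷ xs) (suc (suc k)) = at xs (suc k)

-- s_u = max { s ∈ {1,…,n-1} : s < n - d_{s+1} }  (0 if the set is empty,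
-- in which case the range d_1+1 ≤ s ≤ s_u is empty anyway)
sU : List ℕ → ℕ
sU d = foldr _⊔_ 0
         (map (λ s → if s <ᵇ (length d ∸ at d (suc s)) then s else 0)
              (map suc (upTo (length d ∸ 1))))

-- m = min { i : d_i < l }  (1-based; length d + 1 if no such i)
firstBelow : ℕ → List ℕ → ℕ
firstBelow l []       = 1
firstBelow l (x ∷ xs) = if x <ᵇ l then 1 else suc (firstBelow l xs)

select : (d : List ℕ) → (Fin (length d) → Bool) → List ℕ
select []       f = []
select (x ∷ xs) f = if f zero then x ∷ select xs (λ i → f (suc i))
                              else select xs (λ i → f (suc i))

toℕ1 : ∀ {n} → Fin n → ℕ
toℕ1 zero    = 1
toℕ1 (suc i) = suc (toℕ1 i)

n∣ : List ℕ → ℕ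
n∣ = length

d₁ : List ℕ → ℕ
d₁ d = at d 1

dₙ : List ℕ → ℕ
dₙ d = at d (length d)

Step1 : List ℕ → Set
Step1 d = (d₁ d ≥ n∣ d ∸ 2) ⊎ (dₙ d ≥ ⌊ n∣ d /2⌋)

Step2 : List ℕ → Set
Step2 d = d₁ d ≡ dₙ d

Step3 : List ℕ → Set
Step3 d = Σ ℕ λ s → (d₁ d + 1 ≤ s) × (s ≤ sU d)
            × Graphical (take s d) × Graphical (drop s d)

Step4 : List ℕ → Set
Step4 d = Σ ℕ λ l →
            (dₙ d + 1 ≤ l) × (l ≤ (⌊ n∣ d /2⌋ ⊓ (n∣ d ∸ d₁ d ∸ 1)))
          × (at d (n∣ d + 1 ∸ l) < l)
          × (l ≤ n∣ d ∸ firstBelow l d)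
          × Σ (Fin (length d) → Bool) λ f →
              (length (select d f) ≡ l)
            × (∀ i → f i ≡ true → firstBelow l d ≤ toℕ1 i)
            × (2 ∣ sum (select d f)) × (2 ∣ sum (select d (λ i → not (f i))))
            × Graphical (select d f) × Graphical (select d (λ i → not (f i)))

ProcedureTrue : List ℕ → Set
ProcedureTrue d = Step1 d ⊎ (¬ Step1 d × ¬ Step2 d × ¬ Step3 d × ¬ Step4 d)

{-# OPTIONS --safe #-}
-- A realization splits into two realizations exactly along a union of components, so d fails to be
-- forcibly connected iff it interleaves two nonempty graphical subsequences. Steps (2)-(4) each exhibit
-- such a splitting; in step (2) both parts are constant sequences, realized by circulant graphs.
-- Conversely, take the smaller side of a disconnected realization, of size l ≤ n/2. Its vertices have
-- degree below l, so it lies among the positions from m = min {i : d_i < l} on: if it fills all of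
-- them it is the tail split off in step (3), and otherwise step (4) finds it. Under step (1) any two
-- vertices have degree sum at least n - 1, so they are adjacent or share a neighbour.
module Submission where

open import Defs hiding (sym)

open import Data.Bool using (Bool; true; false; if_then_else_; not; _∧_; _∨_)
open import Data.Bool.Properties
  using (∧-conicalˡ; ∧-conicalʳ; ∨-zeroʳ; ¬-not; not-involutive) renaming (_≟_ to _≟ᵇ_)
open import Data.Fin using (Fin; zero; suc; toℕ; fromℕ; fromℕ<; inject₁)
open import Data.Fin.Properties
  using (any?; toℕ<n; toℕ-fromℕ<; toℕ-fromℕ; toℕ-inject₁; ≤fromℕ) renaming (_≟_ to _≟ᶠ_)
open import Data.List
  using (List; []; _∷_; length; map; foldr; tabulate; lookup; take; drop; applyUpTo; replicate)
open import Data.List.Properties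
  using (length-replicate; length-take; length-drop; map-tabulate; tabulate-lookup; map-upTo;
         map-applyUpTo; foldr-preservesᵇ; foldr-preservesᵒ)
open import Data.List.Relation.Ternary.Interleaving using ([])
open import Data.List.Relation.Ternary.Interleaving.Propositional using (Interleaving; consˡ; consʳ; swap)
open import Data.List.Relation.Ternary.Interleaving.Properties using (interleave-length)
open import Data.List.Relation.Unary.All using (All; []; _∷_)
open import Data.List.Relation.Unary.All.Properties using (applyUpTo⁺₁)
open import Data.List.Relation.Unary.AllPairs using (AllPairs; []; _∷_)
open import Data.List.Relation.Unary.Any.Properties using (applyUpTo⁺)
open import Data.List.Relation.Unary.Linked using ([]; [-]; _∷_)
open import Data.List.Relation.Unary.Linked.Properties using (AllPairs⇒Linked; Linked⇒AllPairs)
open import Data.List.Relation.Unary.Sorted.TotalOrder.Properties using (lookup-mono-≤)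
open import Data.Nat
  using (ℕ; zero; suc; _+_; _*_; _∸_; _⊔_; _⊓_; _≤_; _<_; _<ᵇ_; _≤?_; ⌊_/2⌋; ⌈_/2⌉; ∣_-_∣;
         z≤n; s≤s; s≤s⁻¹)
open import Data.Nat.Divisibility
  using (_∣_; divides; _∣0; ∣m∣n⇒∣m+n; ∣m+n∣m⇒∣n; m∣m*n; ∣m⇒∣m*n; ∣n⇒∣m*n)
open import Data.Nat.ListAction using (sum)
open import Data.Nat.Primality using (euclidsLemma; prime[2])
open import Data.Nat.Properties
open import Algebra.Properties.CommutativeMonoid.Sum +-0-commutativeMonoid
  using (sum-syntax; sum-cong-≗; ∑-distrib-+; sum-init-last)
open import Data.Nat.Tactic.RingSolver using (solve-∀)
open import Data.Product using (Σ; ∃; _×_; _,_; proj₁; proj₂)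
import Data.Product as Product
open import Data.Sum using (_⊎_; inj₁; inj₂; [_,_]′)
import Data.Sum as Sum
open import Function using (_∘_; const)
open import Relation.Binary.Construct.Closure.ReflexiveTransitive using (Star; ε; _◅_; _◅◅_; reverse)
open import Relation.Binary.Properties.TotalOrder ≤-totalOrder using (≥-totalOrder)
open import Relation.Binary.PropositionalEquality
open import Relation.Nullary using (¬_; Dec; yes; no; does; contradiction)
open import Relation.Nullary.Decidable using (dec-true; dec-false; _⊎-dec_)
open import Relation.Nullary.Reflects using (ofʸ; ofⁿ)

-- Counting and degrees

indicator : Bool → ℕ
indicator b = if b then 1 else 0

count : ∀ {n} → (Fin n → Bool) → ℕ
count {n} f = ∑[ i < n ] indicator (f i)

∑-mono-≤ : ∀ {n} {f g : Fin n → ℕ} → (∀ i → f i ≤ g i) → ∑[ i < n ] f i ≤ ∑[ i < n ] g i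
∑-mono-≤ {zero}  f≤g = z≤n
∑-mono-≤ {suc n} f≤g = +-mono-≤ (f≤g zero) (∑-mono-≤ (f≤g ∘ suc))

∑-mono-< : ∀ {n} {f g : Fin n → ℕ} → (∀ i → f i ≤ g i) →
           ∀ {v} → f v < g v → ∑[ i < n ] f i < ∑[ i < n ] g i
∑-mono-< {suc n} f≤g {zero}  fv<gv = +-mono-<-≤ fv<gv (∑-mono-≤ (f≤g ∘ suc))
∑-mono-< {suc n} f≤g {suc v} fv<gv = +-mono-≤-< (f≤g zero) (∑-mono-< (f≤g ∘ suc) fv<gv)

count-true : ∀ n → count {n} (λ _ → true) ≡ n
count-true zero    = refl
count-true (suc n) = cong suc (count-true n)

count-false : ∀ {n} (f : Fin n → Bool) → (∀ i → f i ≡ false) → count f ≡ 0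
count-false {zero}  f f≡false = refl
count-false {suc n} f f≡false rewrite f≡false zero = count-false (f ∘ suc) (f≡false ∘ suc)

count≤n : ∀ {n} (f : Fin n → Bool) → count f ≤ n
count≤n {n} f = subst (count f ≤_) (count-true n) (∑-mono-≤ (indicator≤1 ∘ f))
  where
  indicator≤1 : ∀ b → indicator b ≤ 1
  indicator≤1 false = z≤n
  indicator≤1 true  = ≤-refl

count-< : ∀ {n} {f g : Fin n → Bool} → (∀ i → f i ≡ true → g i ≡ true) →
          ∀ {v} → f v ≡ false → g v ≡ true → count f < count g
count-< {f = f} {g} f⊆g fv gv = ∑-mono-< (λ i → indicator-mono (f i) (f⊆g i)) (indicator-< fv gv)
  where
  indicator-mono : ∀ b {c} → (b ≡ true → c ≡ true) → indicator b ≤ indicator c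
  indicator-mono false b⇒c = z≤n
  indicator-mono true  b⇒c rewrite b⇒c refl = ≤-refl
  indicator-< : ∀ {b c} → b ≡ false → c ≡ true → indicator b < indicator c
  indicator-< refl refl = s≤s z≤n

0<count : ∀ {n} {f : Fin n → Bool} {v} → f v ≡ true → 0 < count f
0<count {n} {f} fv = subst (_< count f) (count-false {n} (const false) (λ _ → refl))
                       (count-< {f = const false} {g = f} (λ _ ()) refl fv)

count<n : ∀ {n} {f : Fin n → Bool} {v} → f v ≡ false → count f < n
count<n {n} {f} fv = subst (count f <_) (count-true n) (count-< {f = f} {g = λ _ → true} (λ _ _ → refl) fv refl)

count+count≡count∨+count∧ : ∀ {n} (f g : Fin n → Bool) →
  count f + count g ≡ count (λ i → f i ∨ g i) + count (λ i → f i ∧ g i)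
count+count≡count∨+count∧ {n} f g = begin
  count f + count g                                    ≡⟨ ∑-distrib-+ (indicator ∘ f) (indicator ∘ g) ⟨
  ∑[ i < n ] (indicator (f i) + indicator (g i))       ≡⟨ sum-cong-≗ (λ i → pointwise (f i) (g i)) ⟩
  ∑[ i < n ] (indicator (f i ∨ g i) + indicator (f i ∧ g i))
    ≡⟨ ∑-distrib-+ (λ i → indicator (f i ∨ g i)) (λ i → indicator (f i ∧ g i)) ⟩
  count (λ i → f i ∨ g i) + count (λ i → f i ∧ g i)    ∎
  where
  open ≡-Reasoning
  pointwise : ∀ a b → indicator a + indicator b ≡ indicator (a ∨ b) + indicator (a ∧ b)
  pointwise false b     = sym (+-identityʳ (indicator b))
  pointwise true  false = refl
  pointwise true  true  = refl

2+count≤n : ∀ {n} {f : Fin n → Bool} {i j} → i ≢ j → f i ≡ false → f j ≡ false → 2 + count f ≤ n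
2+count≤n {n} {f} {i} {j} i≢j fi fj = begin
  suc (suc (count f)) ≤⟨ s≤s (count-< {f = f} {g = f+i} (λ k fk → cong (_∨ _) fk) fi f+i[i]) ⟩
  suc (count f+i)     ≤⟨ count<n {f = f+i} f+i[j] ⟩
  n                   ∎
  where
  open ≤-Reasoning
  f+i : Fin n → Bool
  f+i k = f k ∨ does (k ≟ᶠ i)
  f+i[i] : f+i i ≡ true
  f+i[i] rewrite fi = dec-true (i ≟ᶠ i) refl
  f+i[j] : f+i j ≡ false
  f+i[j] rewrite fj = dec-false (j ≟ᶠ i) (i≢j ∘ sym)

sum-tabulate : ∀ {n} (g : Fin n → ℕ) → sum (tabulate g) ≡ ∑[ i < n ] g i
sum-tabulate {zero}  g = refl
sum-tabulate {suc n} g = cong (g zero +_) (sum-tabulate (g ∘ suc))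

sum-lookup : (L : List ℕ) → sum L ≡ ∑[ i < length L ] lookup L i
sum-lookup L = trans (cong sum (sym (tabulate-lookup L))) (sum-tabulate (lookup L))

degree≡count : ∀ {n} (G : Graph n) i → degree G i ≡ count (adj G i)
degree≡count G i = trans (cong sum (map-tabulate (λ j → j) row)) (sum-tabulate row)
  where
  row : Fin _ → ℕ
  row j = indicator (adj G i j)

degree<n : ∀ {n} (G : Graph n) i → degree G i < n
degree<n {n} G i = subst (_< n) (sym (degree≡count G i)) (count<n (irref G i))

graphical-term< : ∀ {L} → Graphical L → ∀ i → lookup L i < length L
graphical-term< {L} (_ , G , R) i = subst (_< length L) (R i) (degree<n G i)

∑∑-symmetric-even : ∀ {n} (a : Fin n → Fin n → ℕ) → (∀ i j → a i j ≡ a j i) →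
                    (∀ i → a i i ≡ 0) → 2 ∣ ∑[ i < n ] ∑[ j < n ] a i j
∑∑-symmetric-even {zero}  a a-sym a-diag = 2 ∣0
∑∑-symmetric-even {suc n} a a-sym a-diag =
  subst (2 ∣_) (sym split-row₀) (∣m∣n⇒∣m+n (divides r (double≡ r)) rest-even)
  where
  open ≡-Reasoning
  r rest : ℕ
  r = ∑[ j < n ] a zero (suc j)
  rest = ∑[ i < n ] ∑[ j < n ] a (suc i) (suc j)
  rest-even : 2 ∣ rest
  rest-even = ∑∑-symmetric-even (λ i j → a (suc i) (suc j)) (λ i j → a-sym (suc i) (suc j)) (a-diag ∘ suc)
  double≡ : ∀ r → r + r ≡ r * 2
  double≡ = solve-∀
  split-row₀ : ∑[ i < suc n ] ∑[ j < suc n ] a i j ≡ r + r + rest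
  split-row₀ = begin
    (a zero zero + r) + ∑[ i < n ] (a (suc i) zero + ∑[ j < n ] a (suc i) (suc j))
      ≡⟨ cong₂ _+_ (cong (_+ r) (a-diag zero)) (∑-distrib-+ (λ i → a (suc i) zero) _) ⟩
    r + (∑[ i < n ] a (suc i) zero + rest)
      ≡⟨ cong (λ c → r + (c + rest)) (sum-cong-≗ (λ i → a-sym (suc i) zero)) ⟩
    r + (r + rest)
      ≡⟨ +-assoc r r rest ⟨
    r + r + rest ∎

graphical-sum-even : ∀ {L} → Graphical L → 2 ∣ sum L
graphical-sum-even {L} (_ , G , R) = subst (2 ∣_) (sym degree-sum) handshake
  where
  handshake : 2 ∣ ∑[ i < length L ] count (adj G i)
  handshake = ∑∑-symmetric-even (λ i j → indicator (adj G i j))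
                (λ i j → cong indicator (Graph.sym G i j)) (λ i → cong indicator (irref G i))
  degree-sum : sum L ≡ ∑[ i < length L ] count (adj G i)
  degree-sum = trans (sum-lookup L) (sum-cong-≗ (λ i → trans (sym (R i)) (degree≡count G i)))

edge-sym : ∀ {n} (G : Graph n) {i j} → Edge G i j → Edge G j i
edge-sym G {i} {j} = trans (Graph.sym G j i)

path-sym : ∀ {n} (G : Graph n) {i j} → Star (Edge G) i j → Star (Edge G) j i
path-sym G = reverse (edge-sym G)

path-invariant : ∀ {n} (G : Graph n) (f : Fin n → Bool) → (∀ {v w} → Edge G v w → f v ≡ f w) →
                 ∀ {v w} → Star (Edge G) v w → f v ≡ f w
path-invariant G f edge-inv ε        = refl
path-invariant G f edge-inv (e ◅ es) = trans (edge-inv e) (path-invariant G f edge-inv es)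

-- Without an edge or a common neighbour, the neighbourhoods of i and j are disjoint and avoid i and j.
degree-sum⇒path : ∀ {n} (G : Graph n) {i j} → i ≢ j →
                  n ≤ suc (degree G i + degree G j) → Star (Edge G) i j
degree-sum⇒path {n} G {i} {j} i≢j n≤ with adj G i j in i~j
... | true  = i~j ◅ ε
... | false with any? (λ k → adj G i k ∧ adj G j k ≟ᵇ true)
...   | yes (k , i~k∧j~k) = ∧-conicalˡ _ _ i~k∧j~k ◅ edge-sym G (∧-conicalʳ _ _ i~k∧j~k) ◅ ε
...   | no ¬common = contradiction n≤ (<⇒≱ (begin-strict
  suc (degree G i + degree G j)            ≡⟨ cong suc (cong₂ _+_ (degree≡count G i) (degree≡count G j)) ⟩
  suc (count (adj G i) + count (adj G j))  ≡⟨ cong suc (count+count≡count∨+count∧ (adj G i) (adj G j)) ⟩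
  suc (count nbrs + count common)          ≡⟨ cong (λ c → suc (count nbrs + c)) (count-false common no-common) ⟩
  suc (count nbrs + 0)                     ≡⟨ cong suc (+-identityʳ (count nbrs)) ⟩
  suc (count nbrs)                         <⟨ ≤-refl ⟩
  2 + count nbrs                           ≤⟨ 2+count≤n {f = nbrs} i≢j nbrs[i] nbrs[j] ⟩
  n                                        ∎))
  where
  open ≤-Reasoning
  nbrs common : Fin n → Bool
  nbrs k = adj G i k ∨ adj G j k
  common k = adj G i k ∧ adj G j k
  no-common : ∀ k → common k ≡ false
  no-common k with common k in eq
  ... | true  = contradiction (k , eq) ¬common
  ... | false = refl
  nbrs[i] : nbrs i ≡ false
  nbrs[i] rewrite irref G i = trans (Graph.sym G j i) i~j
  nbrs[j] : nbrs j ≡ false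
  nbrs[j] rewrite i~j = irref G j

-- Interleavings

split : ∀ {l r xs : List ℕ} → Interleaving l r xs → Fin (length xs) → Fin (length l) ⊎ Fin (length r)
split (consˡ sp) zero    = inj₁ zero
split (consˡ sp) (suc i) = Sum.map₁ suc (split sp i)
split (consʳ sp) zero    = inj₂ zero
split (consʳ sp) (suc i) = Sum.map₂ suc (split sp i)

join : ∀ {l r xs : List ℕ} → Interleaving l r xs → Fin (length l) ⊎ Fin (length r) → Fin (length xs)
join (consˡ sp) (inj₁ zero)    = zero
join (consˡ sp) (inj₁ (suc a)) = suc (join sp (inj₁ a))
join (consˡ sp) (inj₂ b)       = suc (join sp (inj₂ b))
join (consʳ sp) (inj₁ a)       = suc (join sp (inj₁ a))
join (consʳ sp) (inj₂ zero)    = zero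
join (consʳ sp) (inj₂ (suc b)) = suc (join sp (inj₂ b))

join-split : ∀ {l r xs : List ℕ} (sp : Interleaving l r xs) i → join sp (split sp i) ≡ i
join-split (consˡ sp) zero    = refl
join-split (consˡ sp) (suc i) with split sp i | join-split sp i
... | inj₁ a | eq = cong suc eq
... | inj₂ b | eq = cong suc eq
join-split (consʳ sp) zero    = refl
join-split (consʳ sp) (suc i) with split sp i | join-split sp i
... | inj₁ a | eq = cong suc eq
... | inj₂ b | eq = cong suc eq

split-join : ∀ {l r xs : List ℕ} (sp : Interleaving l r xs) e → split sp (join sp e) ≡ e
split-join (consˡ sp) (inj₁ zero)    = refl
split-join (consˡ sp) (inj₁ (suc a)) = cong (Sum.map₁ suc) (split-join sp (inj₁ a))
split-join (consˡ sp) (inj₂ b)       = cong (Sum.map₁ suc) (split-join sp (inj₂ b))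
split-join (consʳ sp) (inj₁ a)       = cong (Sum.map₂ suc) (split-join sp (inj₁ a))
split-join (consʳ sp) (inj₂ zero)    = refl
split-join (consʳ sp) (inj₂ (suc b)) = cong (Sum.map₂ suc) (split-join sp (inj₂ b))

lookup-join : ∀ {l r xs : List ℕ} (sp : Interleaving l r xs) e →
              lookup xs (join sp e) ≡ [ lookup l , lookup r ]′ e
lookup-join (consˡ sp) (inj₁ zero)    = refl
lookup-join (consˡ sp) (inj₁ (suc a)) = lookup-join sp (inj₁ a)
lookup-join (consˡ sp) (inj₂ b)       = lookup-join sp (inj₂ b)
lookup-join (consʳ sp) (inj₁ a)       = lookup-join sp (inj₁ a)
lookup-join (consʳ sp) (inj₂ zero)    = refl
lookup-join (consʳ sp) (inj₂ (suc b)) = lookup-join sp (inj₂ b)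

lookup-split : ∀ {l r xs : List ℕ} (sp : Interleaving l r xs) i →
               lookup xs i ≡ [ lookup l , lookup r ]′ (split sp i)
lookup-split {xs = xs} sp i = trans (cong (lookup xs) (sym (join-split sp i))) (lookup-join sp (split sp i))

∑-split : ∀ {l r xs : List ℕ} (sp : Interleaving l r xs) (h : Fin (length l) ⊎ Fin (length r) → ℕ) →
          ∑[ i < length xs ] h (split sp i) ≡ ∑[ a < length l ] h (inj₁ a) + ∑[ b < length r ] h (inj₂ b)
∑-split []         h = refl
∑-split (consˡ sp) h = trans (cong (h (inj₁ zero) +_) (∑-split sp (h ∘ Sum.map₁ suc)))
                             (sym (+-assoc (h (inj₁ zero)) _ _))
∑-split {l} (consʳ sp) h = trans (cong (h (inj₂ zero) +_) (∑-split sp (h ∘ Sum.map₂ suc)))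
                             (x+[y+z]≡y+[x+z] (h (inj₂ zero)) (∑[ a < length l ] h (inj₁ a)) _)
  where
  x+[y+z]≡y+[x+z] : ∀ x y z → x + (y + z) ≡ y + (x + z)
  x+[y+z]≡y+[x+z] = solve-∀

degree-split : ∀ {l r xs : List ℕ} (sp : Interleaving l r xs) (G : Graph (length xs)) v →
  degree G v ≡ count (λ a → adj G v (join sp (inj₁ a))) + count (λ b → adj G v (join sp (inj₂ b)))
degree-split sp G v = begin
  degree G v
    ≡⟨ degree≡count G v ⟩
  count (adj G v)
    ≡⟨ sum-cong-≗ (cong (indicator ∘ adj G v) ∘ sym ∘ join-split sp) ⟩
  ∑[ w < _ ] indicator (adj G v (join sp (split sp w)))
    ≡⟨ ∑-split sp (indicator ∘ adj G v ∘ join sp) ⟩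
  count (λ a → adj G v (join sp (inj₁ a))) + count (λ b → adj G v (join sp (inj₂ b))) ∎
  where open ≡-Reasoning

take-drop-interleaving : ∀ s (xs : List ℕ) → Interleaving (take s xs) (drop s xs) xs
take-drop-interleaving zero    []       = []
take-drop-interleaving zero    (x ∷ xs) = consʳ (take-drop-interleaving zero xs)
take-drop-interleaving (suc s) []       = []
take-drop-interleaving (suc s) (x ∷ xs) = consˡ (take-drop-interleaving s xs)

replicate-interleaving : ∀ a b (x : ℕ) → Interleaving (replicate a x) (replicate b x) (replicate (a + b) x)
replicate-interleaving zero    zero    x = []
replicate-interleaving zero    (suc b) x = consʳ (replicate-interleaving zero b x)
replicate-interleaving (suc a) b       x = consˡ (replicate-interleaving a b x)

select-interleaving : (d : List ℕ) (f : Fin (length d) → Bool) →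
                      Interleaving (select d f) (select d (not ∘ f)) d
select-interleaving []       f = []
select-interleaving (x ∷ xs) f with f zero
... | true  = consˡ (select-interleaving xs (f ∘ suc))
... | false = consʳ (select-interleaving xs (f ∘ suc))

select-join₁ : (d : List ℕ) (f : Fin (length d) → Bool) (a : Fin (length (select d f))) →
               f (join (select-interleaving d f) (inj₁ a)) ≡ true
select-join₁ (x ∷ xs) f a with f zero in f₀
select-join₁ (x ∷ xs) f zero    | true  = f₀
select-join₁ (x ∷ xs) f (suc a) | true  = select-join₁ xs (f ∘ suc) a
select-join₁ (x ∷ xs) f a       | false = select-join₁ xs (f ∘ suc) a

select-join₂ : (d : List ℕ) (f : Fin (length d) → Bool) (b : Fin (length (select d (not ∘ f)))) →
               f (join (select-interleaving d f) (inj₂ b)) ≡ false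
select-join₂ (x ∷ xs) f b with f zero in f₀
select-join₂ (x ∷ xs) f b       | true  = select-join₂ xs (f ∘ suc) b
select-join₂ (x ∷ xs) f zero    | false = f₀
select-join₂ (x ∷ xs) f (suc b) | false = select-join₂ xs (f ∘ suc) b

split⇒join : ∀ {l r xs : List ℕ} (sp : Interleaving l r xs) {i e} → split sp i ≡ e → join sp e ≡ i
split⇒join sp {i} i↦e = trans (cong (join sp) (sym i↦e)) (join-split sp i)

left-position : ∀ {l r xs : List ℕ} (sp : Interleaving l r xs) (f : Fin (length xs) → Bool) →
                (∀ b → f (join sp (inj₂ b)) ≡ false) →
                ∀ i → f i ≡ true → ∃ λ a → join sp (inj₁ a) ≡ i
left-position sp f right-false i fi with split sp i in i↦
... | inj₁ a = a , split⇒join sp i↦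
... | inj₂ b = contradiction (trans (sym fi) (trans (cong f (sym (split⇒join sp i↦))) (right-false b))) λ ()

right-position : ∀ {l r xs : List ℕ} (sp : Interleaving l r xs) (f : Fin (length xs) → Bool) →
                 (∀ a → f (join sp (inj₁ a)) ≡ true) →
                 ∀ i → f i ≡ false → ∃ λ b → join sp (inj₂ b) ≡ i
right-position sp f left-true i fi with split sp i in i↦
... | inj₂ b = b , split⇒join sp i↦
... | inj₁ a = contradiction (trans (sym (left-true a)) (trans (cong f (split⇒join sp i↦)) fi)) λ ()

select-cong : (d : List ℕ) {f g : Fin (length d) → Bool} → (∀ i → f i ≡ g i) → select d f ≡ select d g
select-cong []       f≗g = refl
select-cong (x ∷ xs) {f} {g} f≗g rewrite f≗g zero =
  cong (λ L → if g zero then x ∷ L else L) (select-cong xs (f≗g ∘ suc))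

All-left : ∀ {P : ℕ → Set} {l r xs : List ℕ} → Interleaving l r xs → All P xs → All P l
All-left []         []         = []
All-left (consˡ sp) (px ∷ pxs) = px ∷ All-left sp pxs
All-left (consʳ sp) (px ∷ pxs) = All-left sp pxs

AllPairs-left : ∀ {R : ℕ → ℕ → Set} {l r xs : List ℕ} →
                Interleaving l r xs → AllPairs R xs → AllPairs R l
AllPairs-left []         []         = []
AllPairs-left (consˡ sp) (px ∷ pxs) = All-left sp px ∷ AllPairs-left sp pxs
AllPairs-left (consʳ sp) (px ∷ pxs) = AllPairs-left sp pxs

nonIncreasing-left : ∀ {l r xs : List ℕ} → Interleaving l r xs → NonIncreasing xs → NonIncreasing l
nonIncreasing-left sp =
  AllPairs⇒Linked ∘ AllPairs-left sp ∘ Linked⇒AllPairs (λ x≥y y≥z → ≤-trans y≥z x≥y)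

nonIncreasing-right : ∀ {l r xs : List ℕ} → Interleaving l r xs → NonIncreasing xs → NonIncreasing r
nonIncreasing-right sp = nonIncreasing-left (swap sp)

-- Splitting realizations

module DisjointUnion {l r xs : List ℕ} (sp : Interleaving l r xs)
                     (G₁ : Graph (length l)) (G₂ : Graph (length r)) where

  sameSide-adj : Fin (length l) ⊎ Fin (length r) → Fin (length l) ⊎ Fin (length r) → Bool
  sameSide-adj (inj₁ a) (inj₁ b) = adj G₁ a b
  sameSide-adj (inj₁ a) (inj₂ b) = false
  sameSide-adj (inj₂ a) (inj₁ b) = false
  sameSide-adj (inj₂ a) (inj₂ b) = adj G₂ a b

  sameSide-sym : ∀ e e′ → sameSide-adj e e′ ≡ sameSide-adj e′ e
  sameSide-sym (inj₁ a) (inj₁ b) = Graph.sym G₁ a b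
  sameSide-sym (inj₁ a) (inj₂ b) = refl
  sameSide-sym (inj₂ a) (inj₁ b) = refl
  sameSide-sym (inj₂ a) (inj₂ b) = Graph.sym G₂ a b

  sameSide-irref : ∀ e → sameSide-adj e e ≡ false
  sameSide-irref (inj₁ a) = irref G₁ a
  sameSide-irref (inj₂ b) = irref G₂ b

  graph : Graph (length xs)
  graph = record
    { adj   = λ v w → sameSide-adj (split sp v) (split sp w)
    ; sym   = λ v w → sameSide-sym (split sp v) (split sp w)
    ; irref = λ v → sameSide-irref (split sp v)
    }

  realizes : Realizes l G₁ → Realizes r G₂ → Realizes xs graph
  realizes R₁ R₂ v = begin
    degree graph v                                    ≡⟨ degree≡count graph v ⟩
    count (λ w → sameSide-adj (split sp v) (split sp w))
      ≡⟨ ∑-split sp (indicator ∘ sameSide-adj (split sp v)) ⟩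
    count (sameSide-adj (split sp v) ∘ inj₁) + count (sameSide-adj (split sp v) ∘ inj₂)
      ≡⟨ degree-on-side (split sp v) ⟩
    [ lookup l , lookup r ]′ (split sp v)             ≡⟨ lookup-split sp v ⟨
    lookup xs v                                       ∎
    where
    open ≡-Reasoning
    degree-on-side : ∀ e → count (sameSide-adj e ∘ inj₁) + count (sameSide-adj e ∘ inj₂)
                           ≡ [ lookup l , lookup r ]′ e
    degree-on-side (inj₁ a) = begin
      count (adj G₁ a) + count {length r} (const false)
        ≡⟨ cong (count (adj G₁ a) +_) (count-false {length r} (const false) (λ _ → refl)) ⟩
      count (adj G₁ a) + 0                             ≡⟨ +-identityʳ _ ⟩
      count (adj G₁ a)                                 ≡⟨ degree≡count G₁ a ⟨
      degree G₁ a                                      ≡⟨ R₁ a ⟩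
      lookup l a                                       ∎
    degree-on-side (inj₂ b) = begin
      count {length l} (const false) + count (adj G₂ b)
        ≡⟨ cong (_+ count (adj G₂ b)) (count-false {length l} (const false) (λ _ → refl)) ⟩
      count (adj G₂ b)                                 ≡⟨ degree≡count G₂ b ⟨
      degree G₂ b                                      ≡⟨ R₂ b ⟩
      lookup r b                                       ∎

  isLeft : Fin (length l) ⊎ Fin (length r) → Bool
  isLeft = [ const true , const false ]′

  edge-keeps-side : ∀ {v w} → Edge graph v w → isLeft (split sp v) ≡ isLeft (split sp w)
  edge-keeps-side {v} {w} = keeps (split sp v) (split sp w)
    where
    keeps : ∀ e e′ → sameSide-adj e e′ ≡ true → isLeft e ≡ isLeft e′
    keeps (inj₁ a) (inj₁ b) _ = refl
    keeps (inj₂ a) (inj₂ b) _ = refl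

  disconnected : ∀ a b → ¬ Star (Edge graph) (join sp (inj₁ a)) (join sp (inj₂ b))
  disconnected a b path = contradiction true≡false λ ()
    where
    open ≡-Reasoning
    true≡false : true ≡ false
    true≡false = begin
      true                                  ≡⟨ cong isLeft (split-join sp (inj₁ a)) ⟨
      isLeft (split sp (join sp (inj₁ a)))  ≡⟨ path-invariant graph (isLeft ∘ split sp) edge-keeps-side path ⟩
      isLeft (split sp (join sp (inj₂ b)))  ≡⟨ cong isLeft (split-join sp (inj₂ b)) ⟩
      false                                 ∎

interleaving⇒¬forciblyConnected : ∀ {l r xs : List ℕ} → Interleaving l r xs →
  Σ (Graph (length l)) (Realizes l) → Σ (Graph (length r)) (Realizes r) →
  Fin (length l) → Fin (length r) → ¬ ForciblyConnected xs
interleaving⇒¬forciblyConnected sp (G₁ , R₁) (G₂ , R₂) a b fc =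
  disconnected a b (fc graph (realizes R₁ R₂) (join sp (inj₁ a)) (join sp (inj₂ b)))
  where open DisjointUnion sp G₁ G₂

Closed : ∀ {n} → Graph n → (Fin n → Bool) → Set
Closed G C = ∀ {v w} → Edge G v w → C v ≡ C w

restrict : ∀ {m n} → (Fin m → Fin n) → Graph n → Graph m
restrict ι G = record
  { adj   = λ a b → adj G (ι a) (ι b)
  ; sym   = λ a b → Graph.sym G (ι a) (ι b)
  ; irref = λ a → irref G (ι a) }

closed⇒no-crossing : ∀ {n} {G : Graph n} {C} → Closed G C →
                     ∀ {v w} → C v ≡ true → C w ≡ false → adj G v w ≡ false
closed⇒no-crossing {G = G} closed {v} {w} Cv Cw with adj G v w in v~w
... | true  = contradiction (trans (sym Cv) (trans (closed v~w) Cw)) λ ()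
... | false = refl

module Induced {d : List ℕ} {G : Graph (length d)} (R : Realizes d G)
               {C : Fin (length d) → Bool} (closed : Closed G C) where

  sp : Interleaving (select d C) (select d (not ∘ C)) d
  sp = select-interleaving d C

  inside : Fin (length (select d C)) → Fin (length d)
  inside = join sp ∘ inj₁

  outside : Fin (length (select d (not ∘ C))) → Fin (length d)
  outside = join sp ∘ inj₂

  no-crossing : ∀ a b → adj G (inside a) (outside b) ≡ false
  no-crossing a b = closed⇒no-crossing {G = G} closed (select-join₁ d C a) (select-join₂ d C b)

  realizes-inside : Realizes (select d C) (restrict inside G)
  realizes-inside a = begin
    degree (restrict inside G) a                           ≡⟨ degree≡count (restrict inside G) a ⟩
    count own                                              ≡⟨ +-identityʳ _ ⟨
    count own + 0                    ≡⟨ cong (count own +_) (count-false crossing (no-crossing a)) ⟨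
    count own + count crossing                             ≡⟨ degree-split sp G (inside a) ⟨
    degree G (inside a)                                    ≡⟨ R (inside a) ⟩
    lookup d (inside a)                                    ≡⟨ lookup-join sp (inj₁ a) ⟩
    lookup (select d C) a                                  ∎
    where
    open ≡-Reasoning
    own : Fin (length (select d C)) → Bool
    own b = adj G (inside a) (inside b)
    crossing : Fin (length (select d (not ∘ C))) → Bool
    crossing b = adj G (inside a) (outside b)

  realizes-outside : Realizes (select d (not ∘ C)) (restrict outside G)
  realizes-outside b = begin
    degree (restrict outside G) b                          ≡⟨ degree≡count (restrict outside G) b ⟩
    count own                        ≡⟨ cong (_+ count own) (count-false crossing crossing-false) ⟨
    count crossing + count own                             ≡⟨ degree-split sp G (outside b) ⟨
    degree G (outside b)                                   ≡⟨ R (outside b) ⟩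
    lookup d (outside b)                                   ≡⟨ lookup-join sp (inj₂ b) ⟩
    lookup (select d (not ∘ C)) b                          ∎
    where
    open ≡-Reasoning
    own : Fin (length (select d (not ∘ C))) → Bool
    own c = adj G (outside b) (outside c)
    crossing : Fin (length (select d C)) → Bool
    crossing a = adj G (outside b) (inside a)
    crossing-false : ∀ a → crossing a ≡ false
    crossing-false a = trans (Graph.sym G (outside b) (inside a)) (no-crossing a b)

closed-parts-graphical : ∀ {d} → NonIncreasing d → {G : Graph (length d)} → Realizes d G →
  {C : Fin (length d) → Bool} → Closed G C → Graphical (select d C) × Graphical (select d (not ∘ C))
closed-parts-graphical {d} d↘ {G} R {C} closed =
  (nonIncreasing-left sp d↘ , restrict inside G , realizes-inside) ,
  (nonIncreasing-right sp d↘ , restrict outside G , realizes-outside)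
  where open Induced {d} {G} R {C} closed

-- Components

both-true⇒≡ : ∀ {a b} → (a ≡ true → b ≡ true) → (b ≡ true → a ≡ true) → a ≡ b
both-true⇒≡ {false} {false} a⇒b b⇒a = refl
both-true⇒≡ {false} {true}  a⇒b b⇒a = b⇒a refl
both-true⇒≡ {true}  {false} a⇒b b⇒a = sym (a⇒b refl)
both-true⇒≡ {true}  {true}  a⇒b b⇒a = refl

module Reachability {n : ℕ} (G : Graph n) (i : Fin n) where

  ball : ℕ → Fin n → Bool
  ball zero    j = does (i ≟ᶠ j)
  ball (suc k) j = ball k j ∨ does (any? (λ v → ball k v ∧ adj G v j ≟ᵇ true))

  ball-sound : ∀ k j → ball k j ≡ true → Star (Edge G) i j
  ball-sound zero j i≟j with i ≟ᶠ j
  ... | yes refl = ε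
  ball-sound (suc k) j reached with ball k j in earlier
  ... | true  = ball-sound k j earlier
  ... | false with any? (λ v → ball k v ∧ adj G v j ≟ᵇ true)
  ...   | yes (v , v∧v~j) = ball-sound k v (∧-conicalˡ _ _ v∧v~j) ◅◅ (∧-conicalʳ _ _ v∧v~j ◅ ε)

  ball-step : ∀ k {v j} → ball k v ≡ true → Edge G v j → ball (suc k) j ≡ true
  ball-step k {v} {j} v∈ v~j =
    trans (cong (ball k j ∨_) (dec-true (any? _) (v , cong₂ _∧_ v∈ v~j))) (∨-zeroʳ (ball k j))

  ball-mono : ∀ k {j} → ball k j ≡ true → ball (suc k) j ≡ true
  ball-mono k j∈ rewrite j∈ = refl

  Stable : ℕ → Set
  Stable k = ∀ j → ball (suc k) j ≡ true → ball k j ≡ true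

  stable-suc : ∀ k → Stable k → Stable (suc k)
  stable-suc k stable j reached with ball (suc k) j in earlier
  ... | true  = refl
  ... | false with any? (λ v → ball (suc k) v ∧ adj G v j ≟ᵇ true)
  ...   | yes (v , v∧v~j) =
    trans (sym earlier) (ball-step k (stable v (∧-conicalˡ _ _ v∧v~j)) (∧-conicalʳ _ _ v∧v~j))

  grows-or-stable : ∀ k → suc k ≤ count (ball k) ⊎ Stable k
  grows-or-stable zero = inj₁ (0<count {f = ball zero} (dec-true (i ≟ᶠ i) refl))
  grows-or-stable (suc k) with grows-or-stable k
  ... | inj₂ stable = inj₂ (stable-suc k stable)
  ... | inj₁ k<count with any? (λ j → ball (suc k) j ∧ not (ball k j) ≟ᵇ true)
  ...   | yes (j , new) = inj₁ (≤-trans (s≤s k<count)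
            (count-< {f = ball k} {g = ball (suc k)} (λ _ → ball-mono k)
                     (trans (sym (not-involutive (ball k j))) (cong not (∧-conicalʳ _ _ new)))
                     (∧-conicalˡ _ _ new)))
  ...   | no none = inj₂ (stable-suc k old)
    where
    old : Stable k
    old j reached with ball k j ≟ᵇ true
    ... | yes earlier = earlier
    ... | no  new     = contradiction (j , cong₂ _∧_ reached (cong not (¬-not new))) none

  component : Fin n → Bool
  component = ball n

  -- Ball k has more than k vertices until the balls stop growing, so they are stable from radius n on.
  component-stable : Stable n
  component-stable with grows-or-stable n
  ... | inj₁ n<count = contradiction (count≤n (ball n)) (<⇒≱ n<count)
  ... | inj₂ stable  = stable

  component-closed : Closed G component
  component-closed {v} {w} v~w = both-true⇒≡
    (λ v∈ → component-stable w (ball-step n v∈ v~w))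
    (λ w∈ → component-stable v (ball-step n w∈ (edge-sym G v~w)))

  component-root : component i ≡ true
  component-root = root∈ball n
    where
    root∈ball : ∀ k → ball k i ≡ true
    root∈ball zero    = dec-true (i ≟ᶠ i) refl
    root∈ball (suc k) = ball-mono k (root∈ball k)

  reachable? : ∀ j → Star (Edge G) i j ⊎ component j ≡ false
  reachable? j with component j in j∈
  ... | true  = inj₁ (ball-sound n j j∈)
  ... | false = inj₂ refl

at-lookup : ∀ (d : List ℕ) i → at d (suc (toℕ i)) ≡ lookup d i
at-lookup (x ∷ xs) zero    = refl
at-lookup (x ∷ xs) (suc i) = at-lookup xs i

toℕ1≡suc-toℕ : ∀ {n} (i : Fin n) → toℕ1 i ≡ suc (toℕ i)
toℕ1≡suc-toℕ zero    = refl
toℕ1≡suc-toℕ (suc i) = cong suc (toℕ1≡suc-toℕ i)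

lookup-antitone : ∀ {d} → NonIncreasing d →
                  ∀ {i j : Fin (length d)} → toℕ i ≤ toℕ j → lookup d j ≤ lookup d i
lookup-antitone = lookup-mono-≤ ≥-totalOrder

at-antitone : ∀ {d} → NonIncreasing d → ∀ {p q} → p ≤ q → q < length d → at d (suc q) ≤ at d (suc p)
at-antitone {d} d↘ {p} {q} p≤q q<n = subst₂ _≤_ (sym (at≡lookup q<n)) (sym (at≡lookup p<n))
  (lookup-antitone d↘ (subst₂ _≤_ (sym (toℕ-fromℕ< p<n)) (sym (toℕ-fromℕ< q<n)) p≤q))
  where
  p<n : p < length d
  p<n = ≤-<-trans p≤q q<n
  at≡lookup : ∀ {k} (k<n : k < length d) → at d (suc k) ≡ lookup d (fromℕ< k<n)
  at≡lookup k<n = trans (cong (at d ∘ suc) (sym (toℕ-fromℕ< k<n))) (at-lookup d (fromℕ< k<n))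

lookup≤d₁ : ∀ {d} → NonIncreasing d → ∀ i → lookup d i ≤ d₁ d
lookup≤d₁ {x ∷ xs} d↘ i = lookup-antitone d↘ {zero} {i} z≤n

dₙ≤lookup : ∀ {d} → NonIncreasing d → ∀ i → dₙ d ≤ lookup d i
dₙ≤lookup {x ∷ xs} d↘ i = subst (_≤ lookup (x ∷ xs) i) dₙ≡last (lookup-antitone d↘ (≤fromℕ i))
  where
  dₙ≡last : lookup (x ∷ xs) (fromℕ (length xs)) ≡ dₙ (x ∷ xs)
  dₙ≡last = trans (sym (at-lookup (x ∷ xs) (fromℕ (length xs))))
                  (cong (at (x ∷ xs) ∘ suc) (toℕ-fromℕ (length xs)))

d₁-is-a-term : ∀ {d : List ℕ} → Fin (length d) → ∃ λ v → d₁ d ≡ lookup d v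
d₁-is-a-term {x ∷ xs} _ = zero , refl

lookup-positive : ∀ {d} → ZeroFree d → ∀ i → 1 ≤ lookup d i
lookup-positive (px ∷ pxs) zero    = px
lookup-positive (px ∷ pxs) (suc i) = lookup-positive pxs i

firstBelow≤ : ∀ {l} (d : List ℕ) (i : Fin (length d)) → lookup d i < l → firstBelow l d ≤ toℕ1 i
firstBelow≤ {l} (x ∷ xs) i dᵢ<l with x <ᵇ l | <ᵇ-reflects-< x l
firstBelow≤ (x ∷ xs) zero    x<l  | false | ofⁿ x≮l = contradiction x<l x≮l
firstBelow≤ (x ∷ xs) (suc i) dᵢ<l | false | _       = s≤s (firstBelow≤ xs i dᵢ<l)
firstBelow≤ (x ∷ xs) zero    _    | true  | _       = ≤-refl
firstBelow≤ (x ∷ xs) (suc i) _    | true  | _       = s≤s z≤n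

firstBelow-suc : ∀ l (d : List ℕ) → ∃ λ s → firstBelow l d ≡ suc s
firstBelow-suc l []       = 0 , refl
firstBelow-suc l (x ∷ xs) with x <ᵇ l
... | true  = 0 , refl
... | false = firstBelow l xs , refl

at-firstBelow : ∀ {l} (d : List ℕ) {s} → firstBelow l d ≡ suc s → s < length d → at d (suc s) < l
at-firstBelow {l} (x ∷ xs) m≡ s<n with x <ᵇ l | <ᵇ-reflects-< x l
at-firstBelow (x ∷ xs) refl _ | true | ofʸ x<l = x<l
at-firstBelow {l} (x ∷ xs) m≡ s<n | false | _ with firstBelow-suc l xs
... | s′ , m′≡ with trans (sym (suc-injective m≡)) m′≡
... | refl = at-firstBelow xs m′≡ (s≤s⁻¹ s<n)

sU-term : List ℕ → ℕ → ℕ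
sU-term d s = if s <ᵇ (length d ∸ at d (suc s)) then s else 0

sU-as-max : ∀ d → sU d ≡ foldr _⊔_ 0 (applyUpTo (sU-term d ∘ suc) (length d ∸ 1))
sU-as-max d = cong (foldr _⊔_ 0) (trans (cong (map (sU-term d)) (map-upTo suc (length d ∸ 1)))
                                        (map-applyUpTo suc (sU-term d) (length d ∸ 1)))

sU≤n∸1 : ∀ d → sU d ≤ length d ∸ 1
sU≤n∸1 d = subst (_≤ length d ∸ 1) (sym (sU-as-max d))
  (foldr-preservesᵇ {P = _≤ length d ∸ 1} ⊔-lub z≤n (applyUpTo⁺₁ (sU-term d ∘ suc) (length d ∸ 1)
    (λ {k} k<N → ≤-trans (term≤ (suc k)) k<N)))
  where
  term≤ : ∀ s → sU-term d s ≤ s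
  term≤ s with s <ᵇ (length d ∸ at d (suc s))
  ... | true  = ≤-refl
  ... | false = z≤n

sU-maximal : ∀ d {s} → 1 ≤ s → s < length d → s < length d ∸ at d (suc s) → s ≤ sU d
sU-maximal d {suc k} _ s<n s<n∸dₛ₊₁ = subst (suc k ≤_) (sym (sU-as-max d))
  (foldr-preservesᵒ {P = suc k ≤_} (λ x y → [ m≤n⇒m≤n⊔o y , m≤n⇒m≤o⊔n x ]′) 0 _
    (inj₂ (applyUpTo⁺ (sU-term d ∘ suc) (≤-reflexive (sym term≡)) k<N)))
  where
  k<N : k < length d ∸ 1
  k<N = m+n≤o⇒m≤o∸n (suc k) (subst (_≤ length d) (+-comm 1 (suc k)) s<n)
  term≡ : sU-term d (suc k) ≡ suc k
  term≡ with suc k <ᵇ (length d ∸ at d (suc (suc k))) | <ᵇ-reflects-< (suc k) (length d ∸ at d (suc (suc k)))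
  ... | true  | _        = refl
  ... | false | ofⁿ s≮ = contradiction s<n∸dₛ₊₁ s≮

length-select≤ : ∀ (d : List ℕ) f → length (select d f) ≤ length d
length-select≤ d f =
  subst (length (select d f) ≤_) (sym (interleave-length (select-interleaving d f))) (m≤m+n _ _)

select-all : ∀ (d : List ℕ) f → length d ≤ length (select d f) →
             select d f ≡ d × select d (not ∘ f) ≡ []
select-all []       f _ = refl , refl
select-all (x ∷ xs) f n≤ with f zero
... | true  = Product.map₁ (cong (x ∷_)) (select-all xs (f ∘ suc) (s≤s⁻¹ n≤))
... | false = contradiction n≤ (<⇒≱ (s≤s (length-select≤ xs (f ∘ suc))))

select-above : ∀ s (d : List ℕ) f → (∀ v → f v ≡ true → s ≤ toℕ v) →
               length (select d f) ≤ length d ∸ s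
select-above zero    d        f above = length-select≤ d f
select-above (suc s) []       f above = z≤n
select-above (suc s) (x ∷ xs) f above with f zero in f₀
... | true  = contradiction (above zero f₀) λ ()
... | false = select-above s xs (f ∘ suc) (λ v fv → s≤s⁻¹ (above (suc v) fv))

select-above-tight : ∀ s (d : List ℕ) f → (∀ v → f v ≡ true → s ≤ toℕ v) →
                     length d ∸ s ≤ length (select d f) →
                     select d f ≡ drop s d × select d (not ∘ f) ≡ take s d
select-above-tight zero    d        f above tight = select-all d f tight
select-above-tight (suc s) []       f above tight = refl , refl
select-above-tight (suc s) (x ∷ xs) f above tight with f zero in f₀
... | true  = contradiction (above zero f₀) λ ()
... | false = Product.map₂ (cong (x ∷_))
                (select-above-tight s xs (f ∘ suc) (λ v fv → s≤s⁻¹ (above (suc v) fv)) tight)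

m∸n≤1+[m∸1+n] : ∀ m n → m ∸ n ≤ suc (m ∸ suc n)
m∸n≤1+[m∸1+n] zero    n       = subst (_≤ 1) (sym (0∸n≡0 n)) z≤n
m∸n≤1+[m∸1+n] (suc m) zero    = ≤-refl
m∸n≤1+[m∸1+n] (suc m) (suc n) = m∸n≤1+[m∸1+n] m n

n≤1+⌊n/2⌋+⌊n/2⌋ : ∀ n → n ≤ suc (⌊ n /2⌋ + ⌊ n /2⌋)
n≤1+⌊n/2⌋+⌊n/2⌋ n = begin
  n                         ≡⟨ ⌊n/2⌋+⌈n/2⌉≡n n ⟨
  ⌊ n /2⌋ + ⌈ n /2⌉         ≤⟨ +-monoʳ-≤ ⌊ n /2⌋ (⌊n/2⌋-mono (n≤1+n (suc n))) ⟩
  ⌊ n /2⌋ + suc ⌊ n /2⌋     ≡⟨ +-suc ⌊ n /2⌋ ⌊ n /2⌋ ⟩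
  suc (⌊ n /2⌋ + ⌊ n /2⌋)   ∎
  where open ≤-Reasoning

⌊n/2⌋+⌊n/2⌋≤n : ∀ n → ⌊ n /2⌋ + ⌊ n /2⌋ ≤ n
⌊n/2⌋+⌊n/2⌋≤n n =
  subst (⌊ n /2⌋ + ⌊ n /2⌋ ≤_) (⌊n/2⌋+⌈n/2⌉≡n n) (+-monoʳ-≤ ⌊ n /2⌋ (⌊n/2⌋≤⌈n/2⌉ n))

-- All l terms of the small side are below l, which pins it to the positions from firstBelow l d on.
module SmallGraphicalPart
  {d : List ℕ} (d-graphical : Graphical d) (f : Fin (length d) → Bool)
  (left : Graphical (select d f)) (right : Graphical (select d (not ∘ f)))
  (a₀ : Fin (length (select d f))) (small : length (select d f) + length (select d f) ≤ length d) where

  n l r : ℕ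
  n = length d
  l = length (select d f)
  r = length (select d (not ∘ f))

  sp : Interleaving (select d f) (select d (not ∘ f)) d
  sp = select-interleaving d f

  n≡l+r : n ≡ l + r
  n≡l+r = interleave-length sp

  l≤r : l ≤ r
  l≤r = +-cancelˡ-≤ l l r (subst (l + l ≤_) n≡l+r small)

  l≤n : l ≤ n
  l≤n = subst (l ≤_) (sym n≡l+r) (m≤m+n l r)

  0<l : 0 < l
  0<l = ≤-trans (s≤s z≤n) (toℕ<n a₀)

  selected<l : ∀ v → f v ≡ true → lookup d v < l
  selected<l v fv with left-position sp f (select-join₂ d f) v fv
  ... | a , a↦v =
    subst (_< l) (trans (sym (lookup-join sp (inj₁ a))) (cong (lookup d) a↦v)) (graphical-term< left a)

  term<r : ∀ v → lookup d v < r
  term<r v = subst (_< r) (sym (lookup-split sp v)) (bound (split sp v))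
    where
    bound : ∀ e → [ lookup (select d f) , lookup (select d (not ∘ f)) ]′ e < r
    bound (inj₁ a) = ≤-trans (graphical-term< left a) l≤r
    bound (inj₂ b) = graphical-term< right b

  dₙ+1≤l : dₙ d + 1 ≤ l
  dₙ+1≤l = subst (_≤ l) (+-comm 1 (dₙ d))
             (≤-<-trans (dₙ≤lookup {d} (proj₁ d-graphical) v₀) (selected<l v₀ (select-join₁ d f a₀)))
    where
    v₀ : Fin n
    v₀ = join sp (inj₁ a₀)

  l+[d₁+1]≤n : l + (d₁ d + 1) ≤ n
  l+[d₁+1]≤n with d₁-is-a-term {d} (join sp (inj₁ a₀))
  ... | v , d₁≡dᵥ = subst (l + (d₁ d + 1) ≤_) (sym n≡l+r)
                      (+-monoʳ-≤ l (subst (_≤ r) (+-comm 1 (d₁ d)) (subst (_< r) (sym d₁≡dᵥ) (term<r v))))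

  l≤⌊n/2⌋⊓[n∸d₁∸1] : l ≤ ⌊ n /2⌋ ⊓ (n ∸ d₁ d ∸ 1)
  l≤⌊n/2⌋⊓[n∸d₁∸1] = ⊓-glb (subst (_≤ ⌊ n /2⌋) (sym (n≡⌊n+n/2⌋ l)) (⌊n/2⌋-mono small))
                            (subst (l ≤_) (sym (∸-+-assoc n (d₁ d) 1)) (m+n≤o⇒m≤o∸n l l+[d₁+1]≤n))

  s : ℕ
  s = proj₁ (firstBelow-suc l d)

  m≡1+s : firstBelow l d ≡ suc s
  m≡1+s = proj₂ (firstBelow-suc l d)

  selected-above : ∀ v → f v ≡ true → s ≤ toℕ v
  selected-above v fv = s≤s⁻¹ (subst₂ _≤_ m≡1+s (toℕ1≡suc-toℕ v) (firstBelow≤ d v (selected<l v fv)))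

  l≤n∸s : l ≤ n ∸ s
  l≤n∸s = select-above s d f selected-above

  s<n : s < n
  s<n = ≰⇒> (λ n≤s → <⇒≱ 0<l (subst (l ≤_) (m≤n⇒m∸n≡0 n≤s) l≤n∸s))

  s≤n∸l : s ≤ n ∸ l
  s≤n∸l = m+n≤o⇒m≤o∸n s (subst (_≤ n) (+-comm l s) (m≤o∸n⇒m+n≤o l (<⇒≤ s<n) l≤n∸s))

  dₛ₊₁<l : at d (suc s) < l
  dₛ₊₁<l = at-firstBelow d m≡1+s s<n

  tail<l : at d (n + 1 ∸ l) < l
  tail<l = subst (λ k → at d k < l) (sym n+1∸l≡1+[n∸l])
             (≤-<-trans (at-antitone (proj₁ d-graphical) s≤n∸l (∸-monoʳ-< 0<l l≤n)) dₛ₊₁<l)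
    where
    n+1∸l≡1+[n∸l] : n + 1 ∸ l ≡ suc (n ∸ l)
    n+1∸l≡1+[n∸l] = trans (+-∸-comm 1 l≤n) (+-comm (n ∸ l) 1)

  step4 : l ≤ n ∸ firstBelow l d → Step4 d
  step4 l≤n∸m = l , dₙ+1≤l , l≤⌊n/2⌋⊓[n∸d₁∸1] , tail<l , l≤n∸m , f , refl
              , (λ v fv → firstBelow≤ d v (selected<l v fv))
              , graphical-sum-even left , graphical-sum-even right
              , left , right

  step3 : ¬ l ≤ n ∸ firstBelow l d → Step3 d
  step3 l≰n∸m =
    s , d₁+1≤s , s≤sU , subst Graphical (proj₂ parts) right , subst Graphical (proj₁ parts) left
    where
    n∸s≤l : n ∸ s ≤ l
    n∸s≤l = ≤-trans (m∸n≤1+[m∸1+n] n s) (subst (λ m → suc (n ∸ m) ≤ l) m≡1+s (≰⇒> l≰n∸m))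
    parts : select d f ≡ drop s d × select d (not ∘ f) ≡ take s d
    parts = select-above-tight s d f selected-above n∸s≤l
    l≡n∸s : l ≡ n ∸ s
    l≡n∸s = ≤-antisym l≤n∸s n∸s≤l
    d₁+1≤s : d₁ d + 1 ≤ s
    d₁+1≤s = subst (d₁ d + 1 ≤_) (m∸[m∸n]≡n (<⇒≤ s<n))
               (m+n≤o⇒m≤o∸n (d₁ d + 1) (subst (λ k → d₁ d + 1 + k ≤ n) l≡n∸s
                 (subst (_≤ n) (+-comm l (d₁ d + 1)) l+[d₁+1]≤n)))
    s≤sU : s ≤ sU d
    s≤sU = sU-maximal d (≤-trans (m≤n+m 1 (d₁ d)) d₁+1≤s) s<n
             (m+n≤o⇒m≤o∸n (suc s) (subst (_≤ n) (cong suc (+-comm dₛ₊₁ s))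
               (m≤o∸n⇒m+n≤o (suc dₛ₊₁) (<⇒≤ s<n) (subst (dₛ₊₁ <_) l≡n∸s dₛ₊₁<l))))
      where
      dₛ₊₁ : ℕ
      dₛ₊₁ = at d (suc s)

  step3⊎step4 : Step3 d ⊎ Step4 d
  step3⊎step4 with l ≤? n ∸ firstBelow l d
  ... | yes l≤n∸m = inj₂ (step4 l≤n∸m)
  ... | no  l≰n∸m = inj₁ (step3 l≰n∸m)

graphical-split⇒step3⊎step4 : ∀ {d} → Graphical d → (f : Fin (length d) → Bool) →
  Graphical (select d f) → Graphical (select d (not ∘ f)) →
  Fin (length (select d f)) → Fin (length (select d (not ∘ f))) → Step3 d ⊎ Step4 d
graphical-split⇒step3⊎step4 {d} d-graphical f left right a b
  with length (select d f) + length (select d f) ≤? length d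
... | yes left-small = SmallGraphicalPart.step3⊎step4 d-graphical f left right a left-small
... | no  left-large = SmallGraphicalPart.step3⊎step4 d-graphical (not ∘ f) right left′ b right-small
  where
  left′ : Graphical (select d (not ∘ not ∘ f))
  left′ = subst Graphical (select-cong d (sym ∘ not-involutive ∘ f)) left
  l r : ℕ
  l = length (select d f)
  r = length (select d (not ∘ f))
  n≡l+r : length d ≡ l + r
  n≡l+r = interleave-length (select-interleaving d f)
  r<l : r < l
  r<l = +-cancelˡ-< l r l (subst (_< l + l) n≡l+r (≰⇒> left-large))
  right-small : r + r ≤ length d
  right-small = subst (r + r ≤_) (sym n≡l+r) (+-monoˡ-≤ r (<⇒≤ r<l))

-- Regular sequences via circulant graphs

∑-toℕ-snoc : ∀ k (g : ℕ → ℕ) → ∑[ b < suc k ] g (toℕ b) ≡ ∑[ b < k ] g (toℕ b) + g k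
∑-toℕ-snoc k g = begin
  ∑[ b < suc k ] g (toℕ b)                            ≡⟨ sum-init-last (g ∘ toℕ) ⟩
  ∑[ b < k ] g (toℕ (inject₁ b)) + g (toℕ (fromℕ k))
    ≡⟨ cong₂ _+_ (sum-cong-≗ {k} (cong g ∘ toℕ-inject₁)) (cong g (toℕ-fromℕ k)) ⟩
  ∑[ b < k ] g (toℕ b) + g k                          ∎
  where open ≡-Reasoning

cycleDistance : ℕ → ℕ → ℕ
cycleDistance k δ = δ ⊓ (k ∸ δ)

cycleDistance-mirror : ∀ k {δ} → δ ≤ k → cycleDistance k (k ∸ δ) ≡ cycleDistance k δ
cycleDistance-mirror k {δ} δ≤k = trans (cong ((k ∸ δ) ⊓_) (m∸[m∸n]≡n δ≤k)) (⊓-comm (k ∸ δ) δ)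

∑-shift-invariant : ∀ k (h : ℕ → ℕ) → (∀ {δ} → δ ≤ k → h (k ∸ δ) ≡ h δ) →
                    ∀ {a} → a < k → ∑[ b < k ] h ∣ a - toℕ b ∣ ≡ ∑[ b < k ] h (toℕ b)
∑-shift-invariant k       h h-mirror {zero}  a<k = refl
∑-shift-invariant (suc k) h h-mirror {suc a} (s≤s a<k) = begin
  h (suc a) + rest      ≡⟨ cong (_+ rest) (sym (h-mirror (m≤n⇒m≤1+n a<k))) ⟩
  h (k ∸ a) + rest      ≡⟨ cong (λ δ → h δ + rest) (m≤n⇒∣m-n∣≡n∸m (<⇒≤ a<k)) ⟨
  h ∣ a - k ∣ + rest    ≡⟨ +-comm (h ∣ a - k ∣) rest ⟩
  rest + h ∣ a - k ∣    ≡⟨ ∑-toℕ-snoc k (λ b → h ∣ a - b ∣) ⟨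
  ∑[ b < suc k ] h ∣ a - toℕ b ∣  ≡⟨ ∑-shift-invariant (suc k) h h-mirror {a} (m≤n⇒m≤1+n a<k) ⟩
  ∑[ b < suc k ] h (toℕ b)        ∎
  where
  open ≡-Reasoning
  rest : ℕ
  rest = ∑[ b < k ] h ∣ a - toℕ b ∣

circulant : ∀ k (S : ℕ → Bool) → S 0 ≡ false → Graph k
circulant k S S₀ = record
  { adj   = λ i j → S (cycleDistance k ∣ toℕ i - toℕ j ∣)
  ; sym   = λ i j → cong (S ∘ cycleDistance k) (∣-∣-comm (toℕ i) (toℕ j))
  ; irref = λ i → trans (cong (S ∘ cycleDistance k) (∣n-n∣≡0 (toℕ i))) S₀
  }

mirrorSum : (ℕ → ℕ) → ℕ → ℕ
mirrorSum g k = ∑[ δ < suc k ] g (cycleDistance k (toℕ δ))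

circulant-degree : ∀ k S S₀ i → degree (circulant k S S₀) i ≡ mirrorSum (indicator ∘ S) k
circulant-degree k S S₀ i = begin
  degree (circulant k S S₀) i          ≡⟨ degree≡count (circulant k S S₀) i ⟩
  ∑[ j < k ] h ∣ toℕ i - toℕ j ∣       ≡⟨ ∑-shift-invariant k h h-mirror (toℕ<n i) ⟩
  ∑[ j < k ] h (toℕ j)                 ≡⟨ +-identityʳ _ ⟨
  ∑[ j < k ] h (toℕ j) + 0             ≡⟨ cong (λ b → ∑[ j < k ] h (toℕ j) + indicator b) S₀ ⟨
  ∑[ j < k ] h (toℕ j) + indicator (S 0)
    ≡⟨ cong (λ c → ∑[ j < k ] h (toℕ j) + indicator (S c)) cycleDistance-k-k ⟨
  ∑[ j < k ] h (toℕ j) + h k           ≡⟨ ∑-toℕ-snoc k h ⟨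
  mirrorSum (indicator ∘ S) k          ∎
  where
  open ≡-Reasoning
  h : ℕ → ℕ
  h = indicator ∘ S ∘ cycleDistance k
  h-mirror : ∀ {δ} → δ ≤ k → h (k ∸ δ) ≡ h δ
  h-mirror δ≤k = cong (indicator ∘ S) (cycleDistance-mirror k δ≤k)
  cycleDistance-k-k : cycleDistance k k ≡ 0
  cycleDistance-k-k = trans (cong (k ⊓_) (n∸n≡0 k)) (⊓-zeroʳ k)

mirrorSum-suc-suc : ∀ g k → mirrorSum g (suc (suc k)) ≡ g 0 + (mirrorSum (g ∘ suc) k + g 0)
mirrorSum-suc-suc g k = cong (g 0 +_) (begin
  ∑[ δ < suc (suc k) ] g (suc (toℕ δ) ⊓ (suc k ∸ toℕ δ))
    ≡⟨ ∑-toℕ-snoc (suc k) (λ t → g (suc t ⊓ (suc k ∸ t))) ⟩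
  ∑[ δ < suc k ] g (suc (toℕ δ) ⊓ (suc k ∸ toℕ δ)) + g (suc (suc k) ⊓ (k ∸ k))
    ≡⟨ cong₂ _+_ (sum-cong-≗ {suc k} (λ δ → cong (λ c → g (suc (toℕ δ) ⊓ c)) (+-∸-assoc 1 (toℕ≤k δ))))
                 (cong (λ c → g (suc (suc k) ⊓ c)) (n∸n≡0 k)) ⟩
  mirrorSum (g ∘ suc) k + g 0 ∎)
  where
  open ≡-Reasoning
  toℕ≤k : (δ : Fin (suc k)) → toℕ δ ≤ k
  toℕ≤k δ = s≤s⁻¹ (toℕ<n δ)

-- window lo len is the indicator of {lo, ..., lo + len - 1}.
window : ℕ → ℕ → ℕ → Bool
window zero     len δ       = δ <ᵇ len
window (suc lo) len zero    = false
window (suc lo) len (suc δ) = window lo len δ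

window-empty : ∀ lo δ → window lo 0 δ ≡ false
window-empty zero     δ       = refl
window-empty (suc lo) zero    = refl
window-empty (suc lo) (suc δ) = window-empty lo δ

2*-suc : ∀ m → 2 * suc m ≡ suc (suc (2 * m))
2*-suc = solve-∀

2*-suc≰1 : ∀ m → ¬ 2 * suc m ≤ 1
2*-suc≰1 m bound with subst (_≤ 1) (2*-suc m) bound
... | s≤s ()

halve-bound : ∀ m k → 2 * suc m ≤ suc (suc k) → 2 * m ≤ k
halve-bound m k bound = s≤s⁻¹ (s≤s⁻¹ (subst (_≤ suc (suc k)) (2*-suc m) bound))

mirrorSum-window : ∀ lo len k → 2 * (lo + len) ≤ suc k → mirrorSum (indicator ∘ window lo len) k ≡ 2 * len
mirrorSum-window lo zero k _ =
  trans (sum-cong-≗ {suc k} (cong indicator ∘ window-empty lo ∘ cycleDistance k ∘ toℕ))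
        (count-false {suc k} (const false) (λ _ → refl))
mirrorSum-window (suc lo) (suc len) zero bound = contradiction bound (2*-suc≰1 (lo + suc len))
mirrorSum-window (suc lo) (suc len) (suc zero) bound =
  contradiction (m≤n⇒m≤1+n (subst (λ m → 2 * m ≤ 0) (+-suc lo len) (halve-bound (lo + suc len) 0 bound)))
                (2*-suc≰1 (lo + len))
mirrorSum-window (suc lo) (suc len) (suc (suc k)) bound =
  trans (mirrorSum-suc-suc (indicator ∘ window (suc lo) (suc len)) k)
        (trans (+-identityʳ _) (mirrorSum-window lo (suc len) k (halve-bound (lo + suc len) (suc k) bound)))
mirrorSum-window zero (suc len) zero bound = contradiction bound (2*-suc≰1 len)
mirrorSum-window zero (suc zero) (suc zero) bound = refl
mirrorSum-window zero (suc (suc len)) (suc zero) bound =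
  contradiction (m≤n⇒m≤1+n (halve-bound (suc len) 0 bound)) (2*-suc≰1 len)
mirrorSum-window zero (suc len) (suc (suc k)) bound =
  trans (mirrorSum-suc-suc (indicator ∘ window zero (suc len)) k)
        (trans (cong (λ c → 1 + (c + 1)) (mirrorSum-window zero len k (halve-bound len (suc k) bound)))
               (1+[2*m+1]≡2*suc-m len))
  where
  1+[2*m+1]≡2*suc-m : ∀ m → 1 + (2 * m + 1) ≡ 2 * suc m
  1+[2*m+1]≡2*suc-m = solve-∀

mirrorSum-window-middle : ∀ lo len →
  mirrorSum (indicator ∘ window lo (suc len)) (2 * (lo + len)) ≡ suc (2 * len)
mirrorSum-window-middle zero zero = refl
mirrorSum-window-middle zero (suc len) =
  subst (λ k → mirrorSum G k ≡ suc k) (sym (2*-suc len))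
    (trans (mirrorSum-suc-suc G (2 * len))
           (trans (cong (λ c → 1 + (c + 1)) (mirrorSum-window-middle zero len)) (1+[1+m+1]≡3+m (2 * len))))
  where
  G : ℕ → ℕ
  G = indicator ∘ window zero (suc (suc len))
  1+[1+m+1]≡3+m : ∀ m → 1 + (suc m + 1) ≡ suc (suc (suc m))
  1+[1+m+1]≡3+m = solve-∀
mirrorSum-window-middle (suc lo) len =
  subst (λ k → mirrorSum G k ≡ suc (2 * len)) (sym (2*-suc (lo + len)))
    (trans (mirrorSum-suc-suc G (2 * (lo + len))) (trans (+-identityʳ _) (mirrorSum-window-middle lo len)))
  where
  G : ℕ → ℕ
  G = indicator ∘ window (suc lo) (suc len)

even-or-odd : ∀ n → ∃ λ t → n ≡ 2 * t ⊎ n ≡ suc (2 * t)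
even-or-odd zero    = 0 , inj₁ refl
even-or-odd (suc n) with even-or-odd n
... | t , inj₁ n≡2t   = t , inj₂ (cong suc n≡2t)
... | t , inj₂ n≡1+2t = suc t , inj₁ (trans (cong suc n≡1+2t) (sym (2*-suc t)))

2∤odd : ∀ t → ¬ 2 ∣ suc (2 * t)
2∤odd t (divides q 1+2t≡q*2) = even≢odd q t (trans (*-comm 2 q) (sym 1+2t≡q*2))

2∣n*[1+n] : ∀ n → 2 ∣ n * suc n
2∣n*[1+n] n with even-or-odd n
... | t , inj₁ n≡2t   = ∣m⇒∣m*n (suc n) (subst (2 ∣_) (sym n≡2t) (m∣m*n t))
... | t , inj₂ n≡1+2t =
  ∣n⇒∣m*n n (subst (2 ∣_) (sym (trans (cong suc n≡1+2t) (sym (2*-suc t)))) (m∣m*n (suc t)))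

1+2m<2n⇒m<n : ∀ m n → suc (2 * m) < 2 * n → m < n
1+2m<2n⇒m<n m n 1+2m<2n = *-cancelˡ-< 2 m n (≤-trans (n≤1+n (suc (2 * m))) 1+2m<2n)

replicate-nonIncreasing : ∀ k (r : ℕ) → NonIncreasing (replicate k r)
replicate-nonIncreasing zero          r = []
replicate-nonIncreasing (suc zero)    r = [-]
replicate-nonIncreasing (suc (suc k)) r = ≤-refl ∷ replicate-nonIncreasing (suc k) r

lookup-replicate′ : ∀ k (r : ℕ) i → lookup (replicate k r) i ≡ r
lookup-replicate′ (suc k) r zero    = refl
lookup-replicate′ (suc k) r (suc i) = lookup-replicate′ k r i

regular-graph⇒graphical : ∀ {k r} (G : Graph k) → (∀ i → degree G i ≡ r) → Graphical (replicate k r)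
regular-graph⇒graphical {k} {r} G regular =
  replicate-nonIncreasing k r , transport {k} (length-replicate k) G regular
  where
  transport : ∀ {m k} → length (replicate m r) ≡ k → (G : Graph k) → (∀ i → degree G i ≡ r) →
              Σ (Graph (length (replicate m r))) (Realizes (replicate m r))
  transport {m} refl G regular = G , λ i → trans (regular i) (sym (lookup-replicate′ m r i))

-- For r = 2t join the vertices at cyclic distance 1, ..., t; for r = 2t + 1 the cycle length is
-- k = 2h and we use the distances h - t, ..., h, the antipodal distance h contributing one neighbour.
regular-graphical : ∀ {r k} → r < k → 2 ∣ r * k → Graphical (replicate k r)
regular-graphical {r} {k} r<k 2∣rk with even-or-odd r
... | t , inj₁ refl = regular-graph⇒graphical (circulant k (window 1 t) refl) λ i →
  trans (circulant-degree k (window 1 t) refl i)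
        (mirrorSum-window 1 t k (subst (_≤ suc k) (sym (2*-suc t)) (s≤s r<k)))
... | t , inj₂ refl with euclidsLemma (suc (2 * t)) k prime[2] 2∣rk
...   | inj₁ 2∣r = contradiction 2∣r (2∤odd t)
...   | inj₂ (divides h refl) with m≤n⇒∃[o]m+o≡n (1+2m<2n⇒m<n t h (subst (suc (2 * t) <_) (*-comm h 2) r<k))
...     | e , 1+t+e≡h = regular-graph⇒graphical (circulant k S refl) λ i →
  trans (circulant-degree k S refl i)
        (subst (λ m → mirrorSum (indicator ∘ S) m ≡ suc (2 * t)) k≡ (mirrorSum-window-middle (suc e) t))
  where
  S : ℕ → Bool
  S = window (suc e) (suc t)
  k≡ : 2 * (suc e + t) ≡ h * 2
  k≡ = trans (cong (2 *_) (trans (cong suc (+-comm e t)) 1+t+e≡h)) (*-comm 2 h)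

step1⇒forciblyConnected : ∀ {d} → ZeroFree d → NonIncreasing d → Step1 d → ForciblyConnected d
step1⇒forciblyConnected {x ∷ xs} zero-free d↘ (inj₁ d₁≥n∸2) G R i j =
  path-sym G (from-first i) ◅◅ from-first j
  where
  n : ℕ
  n = suc (length xs)
  from-first : ∀ v → Star (Edge G) zero v
  from-first zero    = ε
  from-first (suc v) = degree-sum⇒path G (λ ()) (begin
    n                                   ≤⟨ m≤n+m∸n n 2 ⟩
    2 + (n ∸ 2)                         ≡⟨ cong suc (+-comm 1 (n ∸ 2)) ⟩
    suc (n ∸ 2 + 1)                     ≤⟨ s≤s (+-mono-≤ d₁≥n∸2 (lookup-positive zero-free (suc v))) ⟩
    suc (x + lookup xs v)               ≡⟨ cong suc (cong₂ _+_ (R zero) (R (suc v))) ⟨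
    suc (degree G zero + degree G (suc v)) ∎)
    where open ≤-Reasoning
step1⇒forciblyConnected {d} zero-free d↘ (inj₂ dₙ≥⌊n/2⌋) G R i j with i ≟ᶠ j
... | yes refl = ε
... | no  i≢j  = degree-sum⇒path G i≢j
                   (≤-trans (n≤1+⌊n/2⌋+⌊n/2⌋ (length d)) (s≤s (+-mono-≤ (degree≥ i) (degree≥ j))))
  where
  degree≥ : ∀ v → ⌊ length d /2⌋ ≤ degree G v
  degree≥ v = ≤-trans dₙ≥⌊n/2⌋ (≤-trans (dₙ≤lookup d↘ v) (≤-reflexive (sym (R v))))

¬step3∧¬step4⇒forciblyConnected : ∀ {d} → Graphical d → ¬ Step3 d → ¬ Step4 d → ForciblyConnected d
¬step3∧¬step4⇒forciblyConnected {d} d-graphical ¬step3 ¬step4 G R i j with Reachability.reachable? G i j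
... | inj₁ path = path
... | inj₂ j∉C  = contradiction (graphical-split⇒step3⊎step4 d-graphical C (proj₁ parts) (proj₂ parts)
                    (proj₁ (left-position sp C (select-join₂ d C) i component-root))
                    (proj₁ (right-position sp C (select-join₁ d C) j j∉C)))
                    [ ¬step3 , ¬step4 ]′
  where
  open Reachability G i
  C : Fin (length d) → Bool
  C = component
  sp : Interleaving (select d C) (select d (not ∘ C)) d
  sp = select-interleaving d C
  parts : Graphical (select d C) × Graphical (select d (not ∘ C))
  parts = closed-parts-graphical (proj₁ d-graphical) {G} R component-closed

constant⇒replicate : ∀ (d : List ℕ) {x} → (∀ i → lookup d i ≡ x) → d ≡ replicate (length d) x
constant⇒replicate []       constant = refl
constant⇒replicate (y ∷ ys) constant = cong₂ _∷_ (constant zero) (constant⇒replicate ys (constant ∘ suc))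

sum-replicate : ∀ n x → sum (replicate n x) ≡ n * x
sum-replicate zero    x = refl
sum-replicate (suc n) x = cong (x +_) (sum-replicate n x)

step2⇒¬forciblyConnected : ∀ {d} → Graphical d → ¬ Step1 d → Step2 d → ¬ ForciblyConnected d
step2⇒¬forciblyConnected {d} d-graphical ¬step1 d₁≡dₙ =
  subst (¬_ ∘ ForciblyConnected) (sym d≡x^[a+b])
    (interleaving⇒¬forciblyConnected (replicate-interleaving (suc x) b x)
      (proj₂ (regular-graphical ≤-refl (2∣n*[1+n] x))) (proj₂ (regular-graphical 1+x≤b 2∣x*b))
      zero (fromℕ< (subst (0 <_) (sym (length-replicate b)) (≤-trans (s≤s z≤n) 1+x≤b))))
  where
  n x b : ℕ
  n = length d
  x = d₁ d
  b = n ∸ suc x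
  d↘ : NonIncreasing d
  d↘ = proj₁ d-graphical
  constant : ∀ i → lookup d i ≡ x
  constant i = ≤-antisym (lookup≤d₁ d↘ i) (subst (_≤ lookup d i) (sym d₁≡dₙ) (dₙ≤lookup d↘ i))
  1+x≤⌊n/2⌋ : suc x ≤ ⌊ n /2⌋
  1+x≤⌊n/2⌋ = subst (λ y → suc y ≤ ⌊ n /2⌋) (sym d₁≡dₙ) (≰⇒> (¬step1 ∘ inj₂))
  2+2x≤n : suc x + suc x ≤ n
  2+2x≤n = ≤-trans (+-mono-≤ 1+x≤⌊n/2⌋ 1+x≤⌊n/2⌋) (⌊n/2⌋+⌊n/2⌋≤n n)
  1+x≤b : suc x ≤ b
  1+x≤b = m+n≤o⇒m≤o∸n (suc x) 2+2x≤n
  n≡1+x+b : n ≡ suc x + b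
  n≡1+x+b = sym (m+[n∸m]≡n (≤-trans (m≤m+n (suc x) (suc x)) 2+2x≤n))
  d≡x^[a+b] : d ≡ replicate (suc x + b) x
  d≡x^[a+b] = trans (constant⇒replicate d constant) (cong (λ m → replicate m x) n≡1+x+b)
  2∣x*n : 2 ∣ x * n
  2∣x*n = subst (2 ∣_) (trans (trans (cong sum (constant⇒replicate d constant)) (sum-replicate n x)) (*-comm n x))
                (graphical-sum-even d-graphical)
  2∣x*b : 2 ∣ x * b
  2∣x*b = ∣m+n∣m⇒∣n (subst (2 ∣_) (trans (cong (x *_) n≡1+x+b) (*-distribˡ-+ x (suc x) b)) 2∣x*n)
                     (2∣n*[1+n] x)

step3⇒¬forciblyConnected : ∀ {d} → Step3 d → ¬ ForciblyConnected d
step3⇒¬forciblyConnected {d} (s , d₁+1≤s , s≤sU , take-graphical , drop-graphical) =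
  interleaving⇒¬forciblyConnected (take-drop-interleaving s d) (proj₂ take-graphical) (proj₂ drop-graphical)
    (fromℕ< (subst (0 <_) (sym (trans (length-take s d) (m≤n⇒m⊓n≡m (<⇒≤ s<n)))) 0<s))
    (fromℕ< (subst (0 <_) (sym (length-drop s d)) (m<n⇒0<n∸m s<n)))
  where
  0<s : 0 < s
  0<s = ≤-trans (m≤n+m 1 (d₁ d)) d₁+1≤s
  s<n : s < length d
  s<n = below (length d) 0<s (≤-trans s≤sU (sU≤n∸1 d))
    where
    below : ∀ n {m} → 0 < m → m ≤ n ∸ 1 → m < n
    below zero    0<m m≤0  = contradiction m≤0 (<⇒≱ 0<m)
    below (suc n) 0<m m≤n  = s≤s m≤n

step4⇒¬forciblyConnected : ∀ {d} → Step4 d → ¬ ForciblyConnected d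
step4⇒¬forciblyConnected {d}
  (l , dₙ+1≤l , l≤⌊n/2⌋⊓ , _ , _ , f , |left|≡l , _ , _ , _ , left , right) =
  interleaving⇒¬forciblyConnected sp (proj₂ left) (proj₂ right)
    (fromℕ< (subst (0 <_) (sym |left|≡l) 0<l))
    (fromℕ< (≤-trans 0<l (+-cancelˡ-≤ l l r (subst (l + l ≤_) n≡l+r l+l≤n))))
  where
  sp : Interleaving (select d f) (select d (not ∘ f)) d
  sp = select-interleaving d f
  r : ℕ
  r = length (select d (not ∘ f))
  0<l : 0 < l
  0<l = ≤-trans (m≤n+m 1 (dₙ d)) dₙ+1≤l
  n≡l+r : length d ≡ l + r
  n≡l+r = trans (interleave-length sp) (cong (_+ r) |left|≡l)
  l+l≤n : l + l ≤ length d
  l+l≤n = ≤-trans (+-mono-≤ l≤⌊n/2⌋ l≤⌊n/2⌋) (⌊n/2⌋+⌊n/2⌋≤n (length d))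
    where
    l≤⌊n/2⌋ : l ≤ ⌊ length d /2⌋
    l≤⌊n/2⌋ = ≤-trans l≤⌊n/2⌋⊓ (m⊓n≤m _ _)

step1? : ∀ d → Dec (Step1 d)
step1? d = (length d ∸ 2 ≤? d₁ d) ⊎-dec (⌊ length d /2⌋ ≤? dₙ d)

forciblyConnected⇒procedureTrue : ∀ {d} → Graphical d → ForciblyConnected d → ProcedureTrue d
forciblyConnected⇒procedureTrue {d} d-graphical fc with step1? d
... | yes step1 = inj₁ step1
... | no ¬step1 = inj₂ (¬step1 , (λ step2 → step2⇒¬forciblyConnected d-graphical ¬step1 step2 fc)
                              , (λ step3 → step3⇒¬forciblyConnected step3 fc)
                              , (λ step4 → step4⇒¬forciblyConnected {d} step4 fc))

procedureTrue⇒forciblyConnected : ∀ {d} → Graphical d → ZeroFree d → ProcedureTrue d → ForciblyConnected d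
procedureTrue⇒forciblyConnected d-graphical zero-free (inj₁ step1) =
  step1⇒forciblyConnected zero-free (proj₁ d-graphical) step1
procedureTrue⇒forciblyConnected d-graphical zero-free (inj₂ (_ , _ , ¬step3 , ¬step4)) =
  ¬step3∧¬step4⇒forciblyConnected d-graphical ¬step3 ¬step4

mainTheorem1 : (d : List ℕ) → Graphical d → ZeroFree d →
    (ProcedureTrue d → ForciblyConnected d) × (ForciblyConnected d → ProcedureTrue d)
mainTheorem1 d d-graphical zero-free =
  procedureTrue⇒forciblyConnected d-graphical zero-free , forciblyConnected⇒procedureTrue d-graphical
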